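{- $\mathsf{IKt}2\vdash\neg\neg A^N\leftrightarrow A^N$ for every formula $A$, and $\mathsf{IKt}2\vdash\bot\leftrightarrow\bot^N$.
   Context: Formulas: $A ::= P \mid X \mid A\to B \mid \Box A \mid \blacksquare A \mid \forall X A$, with $\bot := \forall XX$, $\neg A := A\to\bot$, $\leftrightarrow$ the second-order encoded conjunction of both implications, $\Diamond A := \forall X(\Box(A\to\blacksquare X)\to X)$, backward diamond $\Diamond^{\bullet}A := \forall X(\blacksquare(A\to\Box X)\to X)$. $\mathsf{IKt}2$: second-order intuitionistic propositional logic (with full comprehension $\forall XA\to A[C/X]$, modus ponens, generalisation with fresh propositional symbol), distribution axioms $\Box(A\to B)\to\Box A\to\Box B$, $\Box(A\to B)\to\Diamond A\to\Diamond B$, $\blacksquare(A\to B)\to\blacksquare A\to\blacksquare B$, $\blacksquare(A\to B)\to\Diamond^{\bullet}A\to\Diamond^{\bullet}B$, necessitation for $\Box$ and $\blacksquare$, tense axioms $\Diamond^{\bullet}\Box A\to A$, $A\to\Box\Diamond^{\bullet}A$, $\Diamond\blacksquare A\to A$, $A\to\blacksquare\Diamond A$. Negative translation: $P^N := \neg\neg P$, $X^N := \neg\neg X$, $(A\to B)^N := A^N\to B^N$, $(\Box A)^N := \Box A^N$, $(\blacksquare A)^N := \blacksquare A^N$, $(\forall XA)^N := \forall XA^N$; in particular $\bot^N = \forall X\neg\neg X$. -}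

module Defs where

open import Data.Nat using (ℕ; zero; suc; pred; _<ᵇ_; _≡ᵇ_)
open import Data.Bool using (if_then_else_)
open import Data.Product using (_×_)
open import Relation.Nullary using (¬_)
open import Relation.Binary.PropositionalEquality using (_≡_)

-- Formulas of the second-order tense language.
-- Propositional symbols P are named by ℕ ('atom');
-- propositional variables X are de Bruijn indices ('var'), bound by 'all'.
infixr 5 _⇒_
data Fm : Set where
  atom : ℕ → Fm
  var  : ℕ → Fm
  _⇒_  : Fm → Fm → Fm
  □    : Fm → Fm
  ■    : Fm → Fm
  all  : Fm → Fm

shift : ℕ → Fm → Fm
shift c (atom p) = atom p
shift c (var i)  = if i <ᵇ c then var i else var (suc i)
shift c (A ⇒ B)  = shift c A ⇒ shift c B
shift c (□ A)    = □ (shift c A)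
shift c (■ A)    = ■ (shift c A)
shift c (all A)  = all (shift (suc c) A)

-- subst k C A : capture-avoiding substitution of C for variable k in A
-- (variables above k are decremented, since the binder of k disappears)
subst : ℕ → Fm → Fm → Fm
subst k C (atom p) = atom p
subst k C (var i)  = if i <ᵇ k then var i else (if i ≡ᵇ k then C else var (pred i))
subst k C (A ⇒ B)  = subst k C A ⇒ subst k C B
subst k C (□ A)    = □ (subst k C A)
subst k C (■ A)    = ■ (subst k C A)
subst k C (all A)  = all (subst (suc k) (shift 0 C) A)

_[_] : Fm → Fm → Fm
A [ C ] = subst 0 C A

_∉_ : ℕ → Fm → Set
p ∉ atom q = ¬ (p ≡ q)
p ∉ var i  = Data.Unit.⊤ where import Data.Unit
p ∉ (A ⇒ B) = (p ∉ A) × (p ∉ B)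
p ∉ □ A    = p ∉ A
p ∉ ■ A    = p ∉ A
p ∉ all A  = p ∉ A

⊥ : Fm
⊥ = all (var 0)

~_ : Fm → Fm
~ A = A ⇒ ⊥

-- second-order encoded conjunction:  A ∧ B := ∀X((A → B → X) → X)
_∧_ : Fm → Fm → Fm
A ∧ B = all ((shift 0 A ⇒ shift 0 B ⇒ var 0) ⇒ var 0)

_⇔_ : Fm → Fm → Fm
A ⇔ B = (A ⇒ B) ∧ (B ⇒ A)

-- ◇A := ∀X(□(A → ■X) → X)
◇ : Fm → Fm
◇ A = all (□ (shift 0 A ⇒ ■ (var 0)) ⇒ var 0)

-- backward diamond  ◆A := ∀X(■(A → □X) → X)
◆ : Fm → Fm
◆ A = all (■ (shift 0 A ⇒ □ (var 0)) ⇒ var 0)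

infix 3 ⊢_
data ⊢_ : Fm → Set where
  axK   : ∀ {A B} → ⊢ A ⇒ B ⇒ A
  axS   : ∀ {A B C} → ⊢ (A ⇒ B ⇒ C) ⇒ (A ⇒ B) ⇒ A ⇒ C
  axComp : ∀ {A C} → ⊢ all A ⇒ A [ C ]
  -- ∀X(B → A) → B → ∀X A   (X not free in B)
  axAll⇒ : ∀ {A B} → ⊢ all (shift 0 B ⇒ A) ⇒ B ⇒ all A
  axK□  : ∀ {A B} → ⊢ □ (A ⇒ B) ⇒ □ A ⇒ □ B
  axK◇  : ∀ {A B} → ⊢ □ (A ⇒ B) ⇒ ◇ A ⇒ ◇ B
  axK■  : ∀ {A B} → ⊢ ■ (A ⇒ B) ⇒ ■ A ⇒ ■ B
  axK◆  : ∀ {A B} → ⊢ ■ (A ⇒ B) ⇒ ◆ A ⇒ ◆ B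
  axT1  : ∀ {A} → ⊢ ◆ (□ A) ⇒ A
  axT2  : ∀ {A} → ⊢ A ⇒ □ (◆ A)
  axT3  : ∀ {A} → ⊢ ◇ (■ A) ⇒ A
  axT4  : ∀ {A} → ⊢ A ⇒ ■ (◇ A)
  mp    : ∀ {A B} → ⊢ A ⇒ B → ⊢ A → ⊢ B
  nec□  : ∀ {A} → ⊢ A → ⊢ □ A
  nec■  : ∀ {A} → ⊢ A → ⊢ ■ A
  gen   : ∀ {A} (p : ℕ) → p ∉ A → ⊢ A [ atom p ] → ⊢ all A

_ᴺ : Fm → Fm
atom p ᴺ = ~ ~ atom p
var i ᴺ  = ~ ~ var i
(A ⇒ B) ᴺ = A ᴺ ⇒ B ᴺ
□ A ᴺ    = □ (A ᴺ)
■ A ᴺ    = ■ (A ᴺ)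
all A ᴺ  = all (A ᴺ)

-- Aᴺ is built from double negations by ⇒ (in the consequent), □, ■ and ∀, and each of
-- these preserves stability ⊢ ¬¬F → F.  For ⇒ and ∀ this is intuitionistic logic.  For □
-- the tense axioms give ¬¬□C → □¬¬C: by T4 a refutation ¬C yields ■◇¬C, and ◇¬C refutes
-- ¬¬□C, so ◆¬¬□C refutes ¬C; T2 turns ¬¬□C into □◆¬¬□C, hence into □¬¬C.  The case of ■
-- is the mirror image.  F → ¬¬F always holds, and ⊥ ↔ ⊥ᴺ is a pair of instantiations.
module Submission where

open import Defs
open import Data.Product using (_×_; _,_; ∃-syntax)
open import Data.Nat using (ℕ; zero; suc; _⊔_; _≤_; _<ᵇ_; _≡ᵇ_)
open import Data.Nat.Properties using (m⊔n≤o⇒m≤o; m⊔n≤o⇒n≤o; ≤-refl; <⇒≢)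
open import Data.Bool using (true; false)
open import Data.List using (List; []; _∷_)
open import Data.List.Membership.Propositional using (_∈_)
open import Data.List.Relation.Unary.Any using (here; there)
open import Data.Unit using (tt)
open import Relation.Binary.PropositionalEquality using (_≡_; refl; sym; cong; cong₂)

infix 3 _⊩_
data _⊩_ (Γ : List Fm) : Fm → Set where
  hyp : ∀ {A} → A ∈ Γ → Γ ⊩ A
  ax  : ∀ {A} → ⊢ A → Γ ⊩ A
  _∙_ : ∀ {A B} → Γ ⊩ A ⇒ B → Γ ⊩ A → Γ ⊩ B

infixl 9 _∙_
infixr 2 ƛ_

⊢-id : ∀ {A} → ⊢ A ⇒ A
⊢-id {A} = mp (mp (axS {A} {A ⇒ A} {A}) axK) (axK {A} {A})

ƛ_ : ∀ {Γ A B} → (A ∷ Γ) ⊩ B → Γ ⊩ A ⇒ B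
ƛ hyp (here refl) = ax ⊢-id
ƛ hyp (there x)   = ax axK ∙ hyp x
ƛ ax t            = ax axK ∙ ax t
ƛ (f ∙ a)         = ax axS ∙ (ƛ f) ∙ (ƛ a)

closed : ∀ {A} → [] ⊩ A → ⊢ A
closed (ax t)  = t
closed (f ∙ a) = mp (closed f) (closed a)

#0 : ∀ {Γ A} → (A ∷ Γ) ⊩ A
#0 = hyp (here refl)

#1 : ∀ {Γ A B} → (B ∷ A ∷ Γ) ⊩ A
#1 = hyp (there (here refl))

#2 : ∀ {Γ A B C} → (C ∷ B ∷ A ∷ Γ) ⊩ A
#2 = hyp (there (there (here refl)))

⊢-¬¬-intro : ∀ {A} → ⊢ A ⇒ ~ ~ A
⊢-¬¬-intro = closed (ƛ ƛ #0 ∙ #1)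

⊢-ex-falso : ∀ {A} → ⊢ ⊥ ⇒ A
⊢-ex-falso {A} = axComp {var 0} {A}

<ᵇ-false-suc : ∀ i k → (i <ᵇ k) ≡ false → (suc i <ᵇ k) ≡ false × (suc i ≡ᵇ k) ≡ false
<ᵇ-false-suc i       zero    _  = refl , refl
<ᵇ-false-suc (suc i) (suc k) eq = <ᵇ-false-suc i k eq

subst-shift : ∀ k C A → subst k C (shift k A) ≡ A
subst-shift k C (atom p) = refl
subst-shift k C (var i) with i <ᵇ k in eq
... | true rewrite eq = refl
... | false with <ᵇ-false-suc i k eq
...   | lt , ne rewrite lt | ne = refl
subst-shift k C (A ⇒ B) = cong₂ _⇒_ (subst-shift k C A) (subst-shift k C B)
subst-shift k C (□ A)   = cong □ (subst-shift k C A)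
subst-shift k C (■ A)   = cong ■ (subst-shift k C A)
subst-shift k C (all A) = cong all (subst-shift (suc k) (shift 0 C) A)

atomBound : Fm → ℕ
atomBound (atom p) = suc p
atomBound (var i)  = 0
atomBound (A ⇒ B)  = atomBound A ⊔ atomBound B
atomBound (□ A)    = atomBound A
atomBound (■ A)    = atomBound A
atomBound (all A)  = atomBound A

atomBound≤⇒∉ : ∀ A {p} → atomBound A ≤ p → p ∉ A
atomBound≤⇒∉ (atom q) q<p p≡q = <⇒≢ q<p (sym p≡q)
atomBound≤⇒∉ (var i)  _       = tt
atomBound≤⇒∉ (A ⇒ B)  le      =
  atomBound≤⇒∉ A (m⊔n≤o⇒m≤o (atomBound A) _ le) , atomBound≤⇒∉ B (m⊔n≤o⇒n≤o _ (atomBound B) le)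
atomBound≤⇒∉ (□ A)    le      = atomBound≤⇒∉ A le
atomBound≤⇒∉ (■ A)    le      = atomBound≤⇒∉ A le
atomBound≤⇒∉ (all A)  le      = atomBound≤⇒∉ A le

generalise : ∀ {A} → (∀ p → ⊢ A [ atom p ]) → ⊢ all A
generalise {A} ⊢A[p] = gen (atomBound A) (atomBound≤⇒∉ A ≤-refl) (⊢A[p] (atomBound A))

⊢-∧-intro : ∀ {A B} → ⊢ A → ⊢ B → ⊢ A ∧ B
⊢-∧-intro {A} {B} ⊢A ⊢B = generalise pair
  where
  pair : ∀ p → ⊢ (shift 0 A [ atom p ] ⇒ shift 0 B [ atom p ] ⇒ atom p) ⇒ atom p
  pair p rewrite subst-shift 0 (atom p) A | subst-shift 0 (atom p) B = closed (ƛ #0 ∙ ax ⊢A ∙ ax ⊢B)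

⊢-◇⊥-elim : ⊢ ◇ ⊥ ⇒ ⊥
⊢-◇⊥-elim = closed (ƛ ax (axComp {□ (shift 0 ⊥ ⇒ ■ (var 0)) ⇒ var 0} {⊥}) ∙ #0 ∙ ax (nec□ ⊢-ex-falso))

⊢-◆⊥-elim : ⊢ ◆ ⊥ ⇒ ⊥
⊢-◆⊥-elim = closed (ƛ ax (axComp {■ (shift 0 ⊥ ⇒ □ (var 0)) ⇒ var 0} {⊥}) ∙ #0 ∙ ax (nec■ ⊢-ex-falso))

Stable : Fm → Set
Stable F = ⊢ ~ ~ F ⇒ F

¬¬-stable : ∀ {A} → Stable (~ ~ A)
¬¬-stable = closed (ƛ ƛ #1 ∙ (ƛ #0 ∙ #1))

⇒-stable : ∀ {A B} → Stable B → Stable (A ⇒ B)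
⇒-stable stableB = closed (ƛ ƛ ax stableB ∙ (ƛ #2 ∙ (ƛ #1 ∙ (#0 ∙ #2))))

∀-stable : ∀ {F} → (∀ p → Stable (F [ atom p ])) → Stable (all F)
∀-stable {F} stableF[p] = mp axAll⇒ (generalise instance-stable)
  where
  instance-stable : ∀ p → ⊢ shift 0 (~ ~ all F) [ atom p ] ⇒ F [ atom p ]
  instance-stable p rewrite subst-shift 0 (atom p) (~ ~ all F) =
    closed (ƛ ax (stableF[p] p) ∙ (ƛ #1 ∙ (ƛ #1 ∙ (ax axComp ∙ #0))))

-- Stated for an arbitrary pair of modalities with their diamonds, so that it applies to
-- (□, ◇, ■, ◆) and, by the mirror symmetry of the tense axioms, to (■, ◆, □, ◇).
module ¬¬-Shift
  (□′ ◇′ ■′ ◆′ : Fm → Fm)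
  (K□′ : ∀ {A B} → ⊢ □′ (A ⇒ B) ⇒ □′ A ⇒ □′ B)
  (K◇′ : ∀ {A B} → ⊢ □′ (A ⇒ B) ⇒ ◇′ A ⇒ ◇′ B)
  (K■′ : ∀ {A B} → ⊢ ■′ (A ⇒ B) ⇒ ■′ A ⇒ ■′ B)
  (K◆′ : ∀ {A B} → ⊢ ■′ (A ⇒ B) ⇒ ◆′ A ⇒ ◆′ B)
  (nec□′ : ∀ {A} → ⊢ A → ⊢ □′ A)
  (nec■′ : ∀ {A} → ⊢ A → ⊢ ■′ A)
  (A⇒□◆A : ∀ {A} → ⊢ A ⇒ □′ (◆′ A))
  (A⇒■◇A : ∀ {A} → ⊢ A ⇒ ■′ (◇′ A))
  (◇⊥-elim : ⊢ ◇′ ⊥ ⇒ ⊥)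
  (◆⊥-elim : ⊢ ◆′ ⊥ ⇒ ⊥)
  where

  □⇒¬◇¬ : ∀ {C} → ⊢ □′ C ⇒ ~ ◇′ (~ C)
  □⇒¬◇¬ = closed (ƛ ƛ ax ◇⊥-elim ∙ (ax K◇′ ∙ (ax K□′ ∙ ax (nec□′ ⊢-¬¬-intro) ∙ #1) ∙ #0))

  ◇¬⇒¬¬¬□ : ∀ {C} → ⊢ ◇′ (~ C) ⇒ ~ ~ ~ □′ C
  ◇¬⇒¬¬¬□ = closed (ƛ ƛ #0 ∙ (ƛ ax □⇒¬◇¬ ∙ #0 ∙ #2))

  ◆¬¬□⇒¬¬ : ∀ {C} → ⊢ ◆′ (~ ~ □′ C) ⇒ ~ ~ C
  ◆¬¬□⇒¬¬ = closed (ƛ ƛ ax ◆⊥-elim ∙ (ax K◆′ ∙ (ax K■′ ∙ ax (nec■′ ◇¬⇒¬¬¬□) ∙ (ax A⇒■◇A ∙ #0)) ∙ #1))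

  ¬¬□⇒□¬¬ : ∀ {C} → ⊢ ~ ~ □′ C ⇒ □′ (~ ~ C)
  ¬¬□⇒□¬¬ = closed (ƛ ax K□′ ∙ ax (nec□′ ◆¬¬□⇒¬¬) ∙ (ax A⇒□◆A ∙ #0))

  □-stable : ∀ {A} → Stable A → Stable (□′ A)
  □-stable stableA = closed (ƛ ax K□′ ∙ ax (nec□′ stableA) ∙ (ax ¬¬□⇒□¬¬ ∙ #0))

open ¬¬-Shift □ ◇ ■ ◆ axK□ axK◇ axK■ axK◆ nec□ nec■ axT2 axT4 ⊢-◇⊥-elim ⊢-◆⊥-elim
  using (□-stable)
open ¬¬-Shift ■ ◆ □ ◇ axK■ axK◆ axK□ axK◇ nec■ nec□ axT4 axT2 ⊢-◆⊥-elim ⊢-◇⊥-elim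
  using () renaming (□-stable to ■-stable)

-- The index counts the ∀s passed on the way to the double negation.  Instantiating a
-- variable leaves it unchanged, which lets stability recurse through ∀ on the instances
-- F [ atom p ].
data Negative : ℕ → Fm → Set where
  ¬¬_ : ∀ {n} A → Negative n (~ ~ A)
  _⇒_ : ∀ {n B} A → Negative n B → Negative n (A ⇒ B)
  □   : ∀ {n A} → Negative n A → Negative n (□ A)
  ■   : ∀ {n A} → Negative n A → Negative n (■ A)
  all : ∀ {n F} → Negative n F → Negative (suc n) (all F)

Negative-subst : ∀ {n F} k C → Negative n F → Negative n (subst k C F)
Negative-subst k C (¬¬ A)  = ¬¬ subst k C A
Negative-subst k C (A ⇒ B) = subst k C A ⇒ Negative-subst k C B
Negative-subst k C (□ A)   = □ (Negative-subst k C A)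
Negative-subst k C (■ A)   = ■ (Negative-subst k C A)
Negative-subst k C (all F) = all (Negative-subst (suc k) (shift 0 C) F)

Negative⇒Stable : ∀ n {F} → Negative n F → Stable F
Negative⇒Stable n       (¬¬ A)  = ¬¬-stable
Negative⇒Stable n       (A ⇒ B) = ⇒-stable (Negative⇒Stable n B)
Negative⇒Stable n       (□ A)   = □-stable (Negative⇒Stable n A)
Negative⇒Stable n       (■ A)   = ■-stable (Negative⇒Stable n A)
Negative⇒Stable (suc n) (all F) = ∀-stable λ p → Negative⇒Stable n (Negative-subst 0 (atom p) F)

ᴺ-negative : ∀ A → ∃[ n ] Negative n (A ᴺ)
ᴺ-negative (atom p) = 0 , ¬¬ atom p
ᴺ-negative (var i)  = 0 , ¬¬ var i
ᴺ-negative (A ⇒ B) with ᴺ-negative B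
... | n , negB = n , (A ᴺ ⇒ negB)
ᴺ-negative (□ A) with ᴺ-negative A
... | n , negA = n , □ negA
ᴺ-negative (■ A) with ᴺ-negative A
... | n , negA = n , ■ negA
ᴺ-negative (all A) with ᴺ-negative A
... | n , negA = suc n , all negA

ᴺ-stable : ∀ A → Stable (A ᴺ)
ᴺ-stable A with ᴺ-negative A
... | n , negAᴺ = Negative⇒Stable n negAᴺ

⊥ᴺ⇒⊥ : ⊢ ⊥ ᴺ ⇒ ⊥
⊥ᴺ⇒⊥ = closed (ƛ ax (axComp {~ ~ var 0} {⊥}) ∙ #0 ∙ ax ⊢-id)

proposition8p4 : ((A : Fm) → ⊢ (~ ~ (A ᴺ)) ⇔ (A ᴺ)) × (⊢ ⊥ ⇔ (⊥ ᴺ))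
proposition8p4 =
  (λ A → ⊢-∧-intro {~ ~ (A ᴺ) ⇒ A ᴺ} (ᴺ-stable A) (⊢-¬¬-intro {A ᴺ})) ,
  ⊢-∧-intro {⊥ ⇒ ⊥ ᴺ} ⊢-ex-falso ⊥ᴺ⇒⊥
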